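{- Let $q$ be a power of an odd prime, let $n\ge 2$ be an even integer, and let $a,c\in\mathbb{F}_q$, not both zero. Let $f:\mathbb{F}_{q^2}\to\mathbb{F}_{q^2}$ be given by $f(X)=(cX^q+aX)(X^q-X)^{n-1}$. Fix $\beta\in\mathbb{F}_{q^2}\setminus\mathbb{F}_q$ with $\beta^2\in\mathbb{F}_q$, and put $\delta_1=(a-c)(-2)^{n-1}\beta^n$. If $\delta_1=0$, then the functional graph of $f$ on $\mathbb{F}_{q^2}$ has exactly one connected component. Moreover, this component consists of a cycle of length one (the fixed point $0$) together with $2q-2$ other vertices directed to it, and among these $2q-2$ vertices, $q-1$ of them have exactly $q-1$ elements in their preimage.
   Context: The functional graph of a map $f:\mathbb{F}_{q^2}\to\mathbb{F}_{q^2}$ is the directed graph with vertex set $\mathbb{F}_{q^2}$ and an edge $x\to f(x)$ for each $x$; connected components are those of the underlying undirected graph. The preimage of $\alpha$ is $f^{ -1}(\alpha)=\{x\in\mathbb{F}_{q^2}: f(x)=\alpha\}$. A vertex $x$ is "directed to" $\alpha$ if $f(x)=\alpha$. -}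

module Defs where

open import Level using (0ℓ)
open import Data.Nat using (ℕ; zero; suc)
open import Data.Fin using (Fin)
open import Data.List using (List; length; filter; map; allFin)
open import Data.Product using (Σ; _×_)
open import Function.Bundles using (_↔_)
open import Relation.Nullary using (¬_)
open import Relation.Unary using (Pred; Decidable)
open import Relation.Binary.Definitions using (DecidableEquality)
open import Relation.Binary.PropositionalEquality using (_≡_)
open import Relation.Binary.Construct.Closure.Equivalence using (EqClosure)
open import Algebra.Structures using (IsCommutativeRing)

record FiniteField : Set₁ where
  infixl 6 _+_ _-_
  infixl 7 _*_
  field
    Carrier : Set
    _+_ _*_ : Carrier → Carrier → Carrier
    -_      : Carrier → Carrier
    0# 1#   : Carrier
    isCommutativeRing : IsCommutativeRing _≡_ _+_ _*_ -_ 0# 1#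
    0≢1     : ¬ (0# ≡ 1#)
    inverse : ∀ x → ¬ (x ≡ 0#) → Σ Carrier (λ y → x * y ≡ 1#)
    _≟_     : DecidableEquality Carrier
    size    : ℕ
    enum    : Fin size ↔ Carrier

  _-_ : Carrier → Carrier → Carrier
  x - y = x + (- y)

  _^_ : Carrier → ℕ → Carrier
  x ^ zero  = 1#
  x ^ suc m = x * (x ^ m)

  2# : Carrier
  2# = 1# + 1#

  elements : List Carrier
  elements = map (Function.Bundles.Inverse.to enum) (allFin size)

  count : {P : Pred Carrier 0ℓ} → Decidable P → ℕ
  count P? = length (filter P? elements)

  Edge : (Carrier → Carrier) → Carrier → Carrier → Set
  Edge f x y = f x ≡ y

  -- x and y lie in the same connected component of the underlying
  -- undirected graph of the functional graph of f
  SameComponent : (Carrier → Carrier) → Carrier → Carrier → Set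
  SameComponent f = EqClosure (Edge f)

  -- f has exactly one connected component (the field is nonempty)
  OneComponent : (Carrier → Carrier) → Set
  OneComponent f = ∀ x y → SameComponent f x y

  iter : (Carrier → Carrier) → ℕ → Carrier → Carrier
  iter f zero x = x
  iter f (suc k) x = f (iter f k x)

  preimageSize : (Carrier → Carrier) → Carrier → ℕ
  preimageSize f α = count (λ y → f y ≟ α)

-- Since δ₁ = 0 with β ≠ 0 and −2 ≠ 0, we get c = a, so f = a · T · D^(n−1) with
-- T X = X^q + X and D X = X^q − X.  The Frobenius X ↦ X^q is an additive involution
-- of 𝔽_{q²} (q · 1 = 0 and x^(q²) = x by Lagrange), so T takes values in
-- 𝔽_q = {x | x^q = x} and D in β𝔽_q = {x | x^q = −x}; as n − 1 is odd, f takes values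
-- in β𝔽_q, on which T and hence f vanish.  Thus f ∘ f = 0: there is one component,
-- whose only cycle is the fixed point 0.  The zeros of f are 𝔽_q ∪ β𝔽_q, two sets of
-- size q meeting only in 0 (x ↦ βx matches them up, and the fibres of D over β𝔽_q are
-- translates of 𝔽_q, so q² = |β𝔽_q| · |𝔽_q|).  A nonzero s ∈ β𝔽_q has exactly one
-- preimage y with D y = w for each nonzero w ∈ β𝔽_q, namely the one with
-- T y = s / (a w^(n−1)), while a nonzero element of 𝔽_q has no preimage at all.

module Submission where

open import Level using (0ℓ)
open import Defs
open import Data.Bool using (if_then_else_)
open import Data.Empty using (⊥-elim)
open import Data.Fin as Fin using (Fin)
import Data.Fin.Properties as Fin
open import Data.Integer as ℤ using (ℤ; -[1+_]; _⊖_)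
import Data.Integer.Properties as ℤ
open import Data.List as List using (filter; tabulate)
import Data.List.Properties as List
import Data.List.Relation.Unary.All as All
open import Data.Maybe using (Maybe; just; nothing)
open import Data.Nat as N using (ℕ; zero; suc; _≤_; _∸_)
import Data.Nat.Properties as N
open import Data.Nat.Combinatorics using (_C_; nCn≡1; nC1≡n; k>n⇒nCk≡0; nCk+nC[k+1]≡[n+1]C[k+1])
open import Data.Nat.Divisibility using (_∣_; divides; ∣⇒≤)
open import Data.Nat.Primality using (Prime; euclidsLemma; prime⇒nonZero; prime⇒nonTrivial)
open import Data.Nat.Solver using (module +-*-Solver)
open import Data.Product using (Σ; _×_; _,_; proj₁; proj₂)
open import Data.Sign as Sign using (Sign)
open import Data.Sum as ⊎ using (_⊎_; inj₁; inj₂; [_,_]; [_,_]′)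
open import Data.Unit using (⊤; tt)
open import Function using (_∘_; id; _↔_; Inverse; mk↔ₛ′)
open import Function.Construct.Composition using (_↔-∘_)
open import Function.Construct.Symmetry using (↔-sym)
open import Relation.Nullary using (¬_; Dec; yes; no; does)
open import Relation.Nullary.Decidable using (_×-dec_; _⊎-dec_; ¬?)
open import Relation.Unary using (Pred; Decidable)
open import Relation.Binary.Definitions using (tri<; tri≈; tri>)
open import Relation.Binary.PropositionalEquality
  using (_≡_; refl; sym; trans; cong; cong₂; subst; module ≡-Reasoning)
import Relation.Binary.Construct.Closure.Equivalence as EqClosure
import Relation.Binary.Reasoning.Setoid
open import Algebra.Bundles using (CommutativeMonoid; CommutativeRing)
import Algebra.Properties.CommutativeMonoid.Sum
import Algebra.Properties.CommutativeSemiring.Exp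
import Algebra.Properties.Monoid.Mult
import Algebra.Properties.Ring
import Algebra.Properties.Semiring.Binomial
import Algebra.Properties.Semiring.Mult
import Algebra.Properties.Semiring.Sum
import Algebra.Solver.Ring
open import Algebra.Solver.Ring.AlmostCommutativeRing using (_-Raw-AlmostCommutative⟶_; fromCommutativeRing)

[1+k]*[1+n]C[1+k]≡[1+n]*nCk : ∀ n k → suc k N.* (suc n C suc k) ≡ suc n N.* (n C k)
[1+k]*[1+n]C[1+k]≡[1+n]*nCk zero    zero    = refl
[1+k]*[1+n]C[1+k]≡[1+n]*nCk zero    (suc k) =
  trans (cong (suc (suc k) N.*_) (k>n⇒nCk≡0 {1} {suc (suc k)} (N.s≤s (N.s≤s N.z≤n)))) (N.*-zeroʳ (suc (suc k)))
[1+k]*[1+n]C[1+k]≡[1+n]*nCk (suc n) zero    =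
  trans (N.+-identityʳ _) (trans (nC1≡n (suc (suc n))) (sym (N.*-identityʳ _)))
[1+k]*[1+n]C[1+k]≡[1+n]*nCk (suc n) (suc k) = begin
  suc (suc k) N.* (suc (suc n) C suc (suc k))
    ≡⟨ cong (suc (suc k) N.*_) (nCk+nC[k+1]≡[n+1]C[k+1] (suc n) (suc k)) ⟨
  suc (suc k) N.* (A N.+ B)
    ≡⟨ solve 3 (λ k A B → (con 1 :+ k) :* (A :+ B) := (k :* A :+ A) :+ (con 1 :+ k) :* B) refl (suc k) A B ⟩
  (suc k N.* A N.+ A) N.+ suc (suc k) N.* B
    ≡⟨ cong₂ (λ u v → (u N.+ A) N.+ v)
             ([1+k]*[1+n]C[1+k]≡[1+n]*nCk n k) ([1+k]*[1+n]C[1+k]≡[1+n]*nCk n (suc k)) ⟩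
  (suc n N.* (n C k) N.+ A) N.+ suc n N.* (n C suc k)
    ≡⟨ solve 4 (λ m a b A → (m :* a :+ A) :+ m :* b := m :* (a :+ b) :+ A) refl (suc n) (n C k) (n C suc k) A ⟩
  suc n N.* (n C k N.+ n C suc k) N.+ A
    ≡⟨ cong (λ z → suc n N.* z N.+ A) (nCk+nC[k+1]≡[n+1]C[k+1] n k) ⟩
  suc n N.* A N.+ A
    ≡⟨ N.+-comm (suc n N.* A) A ⟩
  suc (suc n) N.* A ∎
  where
  open ≡-Reasoning
  open +-*-Solver
  A = suc n C suc k
  B = suc n C suc (suc k)

p∣pCk : ∀ {p k} → Prime p → 0 N.< k → k N.< p → p ∣ p C k
p∣pCk {suc n} {suc j} p-prime _ k<p
  with euclidsLemma (suc j) (suc n C suc j) p-prime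
         (divides (n C j) (trans ([1+k]*[1+n]C[1+k]≡[1+n]*nCk n j) (N.*-comm (suc n) (n C j))))
... | inj₁ p∣k   = ⊥-elim (N.<⇒≱ k<p (∣⇒≤ p∣k))
... | inj₂ p∣pCk = p∣pCk

¬2∣n⇒n≡1+h*2 : ∀ {n} → ¬ 2 ∣ n → Σ ℕ (λ h → n ≡ suc (h N.* 2))
¬2∣n⇒n≡1+h*2 {zero}        ¬2∣n = ⊥-elim (¬2∣n (divides 0 refl))
¬2∣n⇒n≡1+h*2 {suc zero}    ¬2∣n = 0 , refl
¬2∣n⇒n≡1+h*2 {suc (suc n)} ¬2∣n with ¬2∣n⇒n≡1+h*2 {n} (λ { (divides d refl) → ¬2∣n (divides (suc d) refl) })
... | h , refl = suc h , refl

2∣n⇒n∸1≡1+j*2 : ∀ {n} → 2 N.≤ n → 2 ∣ n → Σ ℕ (λ j → n ∸ 1 ≡ suc (j N.* 2))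
2∣n⇒n∸1≡1+j*2 2≤n (divides zero    refl) = ⊥-elim (N.<⇒≱ 2≤n N.z≤n)
2∣n⇒n∸1≡1+j*2 _   (divides (suc j) refl) = j , refl

m*m≡n*n⇒m≡n : ∀ {m n} → m N.* m ≡ n N.* n → m ≡ n
m*m≡n*n⇒m≡n {m} {n} m²≡n² with N.<-cmp m n
... | tri< m<n _ _ = ⊥-elim (N.<-irrefl m²≡n² (N.*-mono-< m<n m<n))
... | tri≈ _ m≡n _ = m≡n
... | tri> _ _ n<m = ⊥-elim (N.<-irrefl (sym m²≡n²) (N.*-mono-< n<m n<m))

1<p^k : ∀ {p k} → Prime p → 1 N.≤ k → 1 N.< p N.^ k
1<p^k {p} p-prime k≥1 = N.<-≤-trans (N.nonTrivial⇒n>1 p {{prime⇒nonTrivial p-prime}})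
  (N.≤-trans (N.≤-reflexive (sym (N.^-identityʳ p))) (N.^-monoʳ-≤ p {{prime⇒nonZero p-prime}} k≥1))

n∸1+n∸1≡2*n∸2 : ∀ n → (n ∸ 1) N.+ (n ∸ 1) ≡ 2 N.* n ∸ 2
n∸1+n∸1≡2*n∸2 zero    = refl
n∸1+n∸1≡2*n∸2 (suc n) = sym (trans (cong (_∸ 1) (N.+-suc n (n N.+ 0))) (cong (n N.+_) (N.+-identityʳ n)))

module IntegerCoefficients {c ℓ} (R : CommutativeRing c ℓ) where
  open CommutativeRing R renaming (refl to ≈-refl; sym to ≈-sym; trans to ≈-trans; reflexive to ≈-reflexive)
  open Algebra.Properties.Ring ring using (-‿involutive; -‿distribˡ-*; -‿distribʳ-*; -‿+-comm; -0#≈0#)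
  open Algebra.Properties.Semiring.Mult semiring using (×-homo-+; ×1-homo-*) renaming (_×_ to _·_)
  open Relation.Binary.Reasoning.Setoid setoid

  ⟦_⟧ : ℤ → Carrier
  ⟦ ℤ.+ n ⟧    = n · 1#
  ⟦ -[1+ n ] ⟧ = - (suc n · 1#)

  ⟦⟧-homo-⊖ : ∀ m n → ⟦ m ⊖ n ⟧ ≈ m · 1# - n · 1#
  ⟦⟧-homo-⊖ m zero = begin
    ⟦ m ⊖ 0 ⟧          ≡⟨ cong ⟦_⟧ (ℤ.⊖-≥ {m} N.z≤n) ⟩
    m · 1#             ≈⟨ +-identityʳ _ ⟨
    m · 1# + 0#        ≈⟨ +-congˡ -0#≈0# ⟨
    m · 1# - 0 · 1#    ∎
  ⟦⟧-homo-⊖ zero (suc n) = begin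
    ⟦ 0 ⊖ suc n ⟧      ≡⟨ cong ⟦_⟧ (ℤ.⊖-< {0} {suc n} (N.s≤s N.z≤n)) ⟩
    - (suc n · 1#)     ≈⟨ +-identityˡ _ ⟨
    0# - suc n · 1#    ∎
  ⟦⟧-homo-⊖ (suc m) (suc n) = begin
    ⟦ suc m ⊖ suc n ⟧              ≡⟨ cong ⟦_⟧ (ℤ.[1+m]⊖[1+n]≡m⊖n m n) ⟩
    ⟦ m ⊖ n ⟧                      ≈⟨ ⟦⟧-homo-⊖ m n ⟩
    a + - b                        ≈⟨ +-identityˡ _ ⟨
    0# + (a + - b)                 ≈⟨ +-congʳ (-‿inverseʳ 1#) ⟨
    (1# + - 1#) + (a + - b)        ≈⟨ +-assoc 1# (- 1#) _ ⟩
    1# + (- 1# + (a + - b))        ≈⟨ +-congˡ (+-assoc (- 1#) a (- b)) ⟨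
    1# + ((- 1# + a) + - b)        ≈⟨ +-congˡ (+-congʳ (+-comm (- 1#) a)) ⟩
    1# + ((a + - 1#) + - b)        ≈⟨ +-congˡ (+-assoc a (- 1#) (- b)) ⟩
    1# + (a + (- 1# + - b))        ≈⟨ +-assoc 1# a _ ⟨
    (1# + a) + (- 1# + - b)        ≈⟨ +-congˡ (-‿+-comm 1# b) ⟩
    (1# + a) - (1# + b)            ∎
    where a = m · 1#; b = n · 1#

  ⟦⟧-homo-+ : ∀ i j → ⟦ i ℤ.+ j ⟧ ≈ ⟦ i ⟧ + ⟦ j ⟧
  ⟦⟧-homo-+ (ℤ.+ m)  (ℤ.+ n)    = ×-homo-+ 1# m n
  ⟦⟧-homo-+ (ℤ.+ m)  -[1+ n ]   = ⟦⟧-homo-⊖ m (suc n)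
  ⟦⟧-homo-+ -[1+ m ] (ℤ.+ n)    = ≈-trans (⟦⟧-homo-⊖ n (suc m)) (+-comm _ _)
  ⟦⟧-homo-+ -[1+ m ] -[1+ n ] = begin
    - (suc (suc (m N.+ n)) · 1#)       ≡⟨ cong (λ k → - (suc k · 1#)) (N.+-suc m n) ⟨
    - ((suc m N.+ suc n) · 1#)         ≈⟨ -‿cong (×-homo-+ 1# (suc m) (suc n)) ⟩
    - (suc m · 1# + suc n · 1#)        ≈⟨ -‿+-comm _ _ ⟨
    - (suc m · 1#) + - (suc n · 1#)    ∎

  ⟦⟧-homo-neg : ∀ i → ⟦ ℤ.- i ⟧ ≈ - ⟦ i ⟧
  ⟦⟧-homo-neg (ℤ.+ zero)  = ≈-sym -0#≈0#
  ⟦⟧-homo-neg (ℤ.+ suc n) = ≈-refl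
  ⟦⟧-homo-neg -[1+ n ]    = ≈-sym (-‿involutive _)

  signValue : Sign → Carrier
  signValue Sign.+ = 1#
  signValue Sign.- = - 1#

  signValue-homo-* : ∀ s t → signValue (s Sign.* t) ≈ signValue s * signValue t
  signValue-homo-* Sign.+ t      = ≈-sym (*-identityˡ _)
  signValue-homo-* Sign.- Sign.+ = ≈-sym (*-identityʳ _)
  signValue-homo-* Sign.- Sign.- = begin
    1#             ≈⟨ -‿involutive 1# ⟨
    - (- 1#)       ≈⟨ -‿cong (*-identityʳ (- 1#)) ⟨
    - (- 1# * 1#)  ≈⟨ -‿distribʳ-* (- 1#) 1# ⟩
    - 1# * - 1#    ∎

  ⟦⟧-◃ : ∀ s n → ⟦ s ℤ.◃ n ⟧ ≈ signValue s * (n · 1#)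
  ⟦⟧-◃ s      zero    = ≈-sym (zeroʳ _)
  ⟦⟧-◃ Sign.+ (suc n) = ≈-sym (*-identityˡ _)
  ⟦⟧-◃ Sign.- (suc n) = ≈-trans (-‿cong (≈-sym (*-identityˡ _))) (-‿distribˡ-* 1# _)

  ⟦⟧-sign-abs : ∀ i → ⟦ i ⟧ ≈ signValue (ℤ.sign i) * (ℤ.∣ i ∣ · 1#)
  ⟦⟧-sign-abs i = ≈-trans (≈-reflexive (cong ⟦_⟧ (sym (ℤ.◃-inverse i)))) (⟦⟧-◃ (ℤ.sign i) ℤ.∣ i ∣)

  ⟦⟧-homo-* : ∀ i j → ⟦ i ℤ.* j ⟧ ≈ ⟦ i ⟧ * ⟦ j ⟧
  ⟦⟧-homo-* i j = begin
    ⟦ i ℤ.* j ⟧                              ≈⟨ ⟦⟧-◃ (s Sign.* t) (m N.* n) ⟩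
    signValue (s Sign.* t) * (m N.* n) · 1#  ≈⟨ *-cong (signValue-homo-* s t) (×1-homo-* m n) ⟩
    (σ * τ) * (a * b)                        ≈⟨ *-assoc σ τ _ ⟩
    σ * (τ * (a * b))                        ≈⟨ *-congˡ (*-assoc τ a b) ⟨
    σ * ((τ * a) * b)                        ≈⟨ *-congˡ (*-congʳ (*-comm τ a)) ⟩
    σ * ((a * τ) * b)                        ≈⟨ *-congˡ (*-assoc a τ b) ⟩
    σ * (a * (τ * b))                        ≈⟨ *-assoc σ a _ ⟨
    (σ * a) * (τ * b)                        ≈⟨ *-cong (⟦⟧-sign-abs i) (⟦⟧-sign-abs j) ⟨
    ⟦ i ⟧ * ⟦ j ⟧                            ∎
    where
    s = ℤ.sign i; t = ℤ.sign j; m = ℤ.∣ i ∣; n = ℤ.∣ j ∣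
    σ = signValue s; τ = signValue t; a = m · 1#; b = n · 1#

  ⟦⟧-homomorphism : ℤ.+-*-rawRing -Raw-AlmostCommutative⟶ fromCommutativeRing R
  ⟦⟧-homomorphism = record
    { ⟦_⟧ = ⟦_⟧ ; +-homo = ⟦⟧-homo-+ ; *-homo = ⟦⟧-homo-* ; -‿homo = ⟦⟧-homo-neg
    ; 0-homo = ≈-refl ; 1-homo = +-identityʳ 1# }

  ⟦⟧-≟ : ∀ i j → Maybe (⟦ i ⟧ ≈ ⟦ j ⟧)
  ⟦⟧-≟ i j with i ℤ.≟ j
  ... | yes refl = just ≈-refl
  ... | no  _    = nothing

  open Algebra.Solver.Ring ℤ.+-*-rawRing (fromCommutativeRing R) ⟦⟧-homomorphism ⟦⟧-≟ public
    using (solve; _:=_; _:+_; _:-_; _:*_; :-_)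

module FieldArithmetic (K : FiniteField) where
  open FiniteField K

  commutativeRing : CommutativeRing 0ℓ 0ℓ
  commutativeRing = record { isCommutativeRing = isCommutativeRing }

  open CommutativeRing commutativeRing public
    using ( +-assoc; +-comm; +-identityˡ; +-identityʳ; -‿inverseˡ; -‿inverseʳ
          ; *-assoc; *-comm; *-identityˡ; *-identityʳ; zeroˡ; zeroʳ; distribˡ; distribʳ
          ; semiring; commutativeSemiring )
  open Algebra.Properties.Ring (CommutativeRing.ring commutativeRing) public
    using ( -‿involutive; -‿distribˡ-*; -‿distribʳ-*; -0#≈0#; x∙y⁻¹≈ε⇒x≈y
          ; +-identityʳ-unique; +-inverseˡ-unique )
  open Algebra.Properties.Semiring.Mult semiring public
    using (×-assoc-*; ×1-homo-*) renaming (_×_ to _·_)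
  open IntegerCoefficients commutativeRing public
    using (solve; _:=_; _:+_; _:-_; _:*_; :-_)
  private
    module Exp = Algebra.Properties.CommutativeSemiring.Exp commutativeSemiring
  open ≡-Reasoning

  ^≡Exp^ : ∀ x n → x ^ n ≡ x Exp.^ n
  ^≡Exp^ x zero    = refl
  ^≡Exp^ x (suc n) = cong (x *_) (^≡Exp^ x n)

  ^-homo-* : ∀ x m n → x ^ (m N.+ n) ≡ x ^ m * x ^ n
  ^-homo-* x m n = begin
    x ^ (m N.+ n)             ≡⟨ ^≡Exp^ x (m N.+ n) ⟩
    x Exp.^ (m N.+ n)         ≡⟨ Exp.^-homo-* x m n ⟩
    x Exp.^ m * x Exp.^ n     ≡⟨ cong₂ _*_ (^≡Exp^ x m) (^≡Exp^ x n) ⟨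
    x ^ m * x ^ n             ∎

  ^-assocʳ : ∀ x m n → (x ^ m) ^ n ≡ x ^ (m N.* n)
  ^-assocʳ x m n = begin
    (x ^ m) ^ n               ≡⟨ trans (^≡Exp^ (x ^ m) n) (cong (Exp._^ n) (^≡Exp^ x m)) ⟩
    (x Exp.^ m) Exp.^ n       ≡⟨ Exp.^-assocʳ x m n ⟩
    x Exp.^ (m N.* n)         ≡⟨ ^≡Exp^ x (m N.* n) ⟨
    x ^ (m N.* n)             ∎

  ^-distrib-* : ∀ x y n → (x * y) ^ n ≡ x ^ n * y ^ n
  ^-distrib-* x y n = begin
    (x * y) ^ n               ≡⟨ ^≡Exp^ (x * y) n ⟩
    (x * y) Exp.^ n           ≡⟨ Exp.^-distrib-* x y n ⟩
    x Exp.^ n * y Exp.^ n     ≡⟨ cong₂ _*_ (^≡Exp^ x n) (^≡Exp^ y n) ⟨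
    x ^ n * y ^ n             ∎

  1^n≡1 : ∀ n → 1# ^ n ≡ 1#
  1^n≡1 zero    = refl
  1^n≡1 (suc n) = trans (*-identityˡ _) (1^n≡1 n)

  1≢0 : ¬ 1# ≡ 0#
  1≢0 = 0≢1 ∘ sym

  _⁻¹ : Carrier → Carrier
  x ⁻¹ with x ≟ 0#
  ... | yes _   = 0#
  ... | no  x≢0 = proj₁ (inverse x x≢0)

  *-inverseʳ : ∀ {x} → ¬ x ≡ 0# → x * x ⁻¹ ≡ 1#
  *-inverseʳ {x} x≢0 with x ≟ 0#
  ... | yes x≡0  = ⊥-elim (x≢0 x≡0)
  ... | no  x≢0′ = proj₂ (inverse x x≢0′)

  *-inverseˡ : ∀ {x} → ¬ x ≡ 0# → x ⁻¹ * x ≡ 1#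
  *-inverseˡ {x} x≢0 = trans (*-comm (x ⁻¹) x) (*-inverseʳ x≢0)

  x*y≡0⇒x≡0⊎y≡0 : ∀ x y → x * y ≡ 0# → x ≡ 0# ⊎ y ≡ 0#
  x*y≡0⇒x≡0⊎y≡0 x y xy≡0 with x ≟ 0#
  ... | yes x≡0 = inj₁ x≡0
  ... | no  x≢0 = inj₂ (begin
    y                 ≡⟨ *-identityˡ y ⟨
    1# * y            ≡⟨ cong (_* y) (*-inverseˡ x≢0) ⟨
    (x ⁻¹ * x) * y    ≡⟨ *-assoc (x ⁻¹) x y ⟩
    x ⁻¹ * (x * y)    ≡⟨ cong (x ⁻¹ *_) xy≡0 ⟩
    x ⁻¹ * 0#         ≡⟨ zeroʳ (x ⁻¹) ⟩
    0#                ∎)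

  *-≢0 : ∀ {x y} → ¬ x ≡ 0# → ¬ y ≡ 0# → ¬ x * y ≡ 0#
  *-≢0 {x} {y} x≢0 y≢0 xy≡0 = [ x≢0 , y≢0 ] (x*y≡0⇒x≡0⊎y≡0 x y xy≡0)

  ^-≢0 : ∀ {x} n → ¬ x ≡ 0# → ¬ x ^ n ≡ 0#
  ^-≢0 zero    x≢0 = 1≢0
  ^-≢0 (suc n) x≢0 = *-≢0 x≢0 (^-≢0 n x≢0)

  x^n≡0⇒x≡0 : ∀ {x} n → x ^ n ≡ 0# → x ≡ 0#
  x^n≡0⇒x≡0 {x} n xⁿ≡0 with x ≟ 0#
  ... | yes x≡0 = x≡0
  ... | no  x≢0 = ⊥-elim (^-≢0 n x≢0 xⁿ≡0)

  x-y≡0⇒x≡y : ∀ {x y} → x - y ≡ 0# → x ≡ y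
  x-y≡0⇒x≡y = x∙y⁻¹≈ε⇒x≈y _ _

  x*y≡0⇒x≡0 : ∀ {x y} → ¬ y ≡ 0# → x * y ≡ 0# → x ≡ 0#
  x*y≡0⇒x≡0 {x} {y} y≢0 xy≡0 = [ id , ⊥-elim ∘ y≢0 ]′ (x*y≡0⇒x≡0⊎y≡0 x y xy≡0)

  *-cancelʳ : ∀ {x y z} → ¬ z ≡ 0# → x * z ≡ y * z → x ≡ y
  *-cancelʳ {x} {y} {z} z≢0 xz≡yz = x-y≡0⇒x≡y (x*y≡0⇒x≡0 z≢0 (begin
    (x - y) * z       ≡⟨ solve 3 (λ x y z → (x :- y) :* z := x :* z :- y :* z) refl x y z ⟩
    x * z - y * z     ≡⟨ cong (_- y * z) xz≡yz ⟩
    y * z - y * z     ≡⟨ -‿inverseʳ (y * z) ⟩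
    0#                ∎))

  ·1-homo-^ : ∀ m n → (m N.^ n) · 1# ≡ (m · 1#) ^ n
  ·1-homo-^ m zero    = +-identityʳ 1#
  ·1-homo-^ m (suc n) = trans (×1-homo-* m (m N.^ n)) (cong ((m · 1#) *_) (·1-homo-^ m n))

  0^n≡0 : ∀ {n} → 1 N.≤ n → 0# ^ n ≡ 0#
  0^n≡0 (N.s≤s _) = zeroˡ _

  x+x≡2#*x : ∀ x → x + x ≡ 2# * x
  x+x≡2#*x x = sym (trans (distribʳ x 1# 1#) (cong₂ _+_ (*-identityˡ x) (*-identityˡ x)))

module Summation (K : FiniteField) {c ℓ} (M : CommutativeMonoid c ℓ) where
  open FiniteField K using (Carrier; size; enum)
  open CommutativeMonoid M using (_≈_; _∙_; monoid)
    renaming (Carrier to A; trans to ≈-trans; reflexive to ≈-reflexive)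
  open Algebra.Properties.CommutativeMonoid.Sum M using (sum; sum-cong-≋; ∑-distrib-+; ∑-comm; sum-permute; sum-replicate)
  open Algebra.Properties.Monoid.Mult monoid using () renaming (_×_ to _·_)

  ∑ : (Carrier → A) → A
  ∑ g = sum (g ∘ Inverse.to enum)

  ∑-cong : ∀ {g h} → (∀ x → g x ≈ h x) → ∑ g ≈ ∑ h
  ∑-cong g≈h = sum-cong-≋ (g≈h ∘ Inverse.to enum)

  ∑-distrib : ∀ g h → ∑ (λ x → g x ∙ h x) ≈ ∑ g ∙ ∑ h
  ∑-distrib g h = ∑-distrib-+ (g ∘ Inverse.to enum) (h ∘ Inverse.to enum)

  ∑-swap : ∀ (h : Carrier → Carrier → A) → ∑ (λ x → ∑ (h x)) ≈ ∑ (λ y → ∑ (λ x → h x y))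
  ∑-swap h = ∑-comm (λ i j → h (Inverse.to enum i) (Inverse.to enum j))

  ∑-const : ∀ a → ∑ (λ _ → a) ≈ size · a
  ∑-const a = sum-replicate size

  ∑-reindex : ∀ (π : Carrier ↔ Carrier) g → ∑ g ≈ ∑ (g ∘ Inverse.to π)
  ∑-reindex π g = ≈-trans (sum-permute (g ∘ Inverse.to enum) (↔-sym enum ↔-∘ (π ↔-∘ enum)))
    (sum-cong-≋ {size} (λ i → ≈-reflexive (cong g (Inverse.strictlyInverseˡ enum _))))

𝟙 : {P : Set} → Dec P → ℕ
𝟙 (yes _) = 1
𝟙 (no _)  = 0

𝟙-cong : {P Q : Set} (p : Dec P) (q : Dec Q) → (P → Q) → (Q → P) → 𝟙 p ≡ 𝟙 q
𝟙-cong (yes _) (yes _) _   _   = refl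
𝟙-cong (yes p) (no ¬q) p→q _   = ⊥-elim (¬q (p→q p))
𝟙-cong (no ¬p) (yes q) _   q→p = ⊥-elim (¬p (q→p q))
𝟙-cong (no _)  (no _)  _   _   = refl

module ℕ-Sum = Algebra.Properties.CommutativeMonoid.Sum N.+-0-commutativeMonoid

length-filter-tabulate : ∀ {A : Set} {P : Pred A 0ℓ} (P? : Decidable P) {n} (h : Fin n → A)
  → List.length (filter P? (tabulate h)) ≡ ℕ-Sum.sum (λ i → 𝟙 (P? (h i)))
length-filter-tabulate P? {zero}  h = refl
length-filter-tabulate P? {suc n} h with P? (h Fin.zero)
... | yes _ = cong suc (length-filter-tabulate P? (h ∘ Fin.suc))
... | no  _ = length-filter-tabulate P? (h ∘ Fin.suc)

sum-𝟙-≟ : ∀ {n} (j : Fin n) → ℕ-Sum.sum (λ i → 𝟙 (i Fin.≟ j)) ≡ 1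
sum-𝟙-≟ {suc n} Fin.zero    = cong suc (ℕ-Sum.sum-replicate-zero n)
sum-𝟙-≟ {suc n} (Fin.suc j) = trans
  (ℕ-Sum.sum-cong-≗ (λ i → 𝟙-cong (Fin.suc i Fin.≟ Fin.suc j) (i Fin.≟ j) Fin.suc-injective (cong Fin.suc)))
  (sum-𝟙-≟ j)

module Counting (K : FiniteField) where
  open FiniteField K
  open Summation K N.+-0-commutativeMonoid public using (∑; ∑-cong; ∑-distrib; ∑-swap)
  open ≡-Reasoning

  private
    variable
      P Q : Pred Carrier 0ℓ

  count≡∑𝟙 : (P? : Decidable P) → count P? ≡ ∑ (λ x → 𝟙 (P? x))
  count≡∑𝟙 P? = trans (cong (List.length ∘ filter P?) (List.map-tabulate id (Inverse.to enum)))
                      (length-filter-tabulate P? (Inverse.to enum))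

  count-cong : (P? : Decidable P) (Q? : Decidable Q) → (∀ {x} → P x → Q x) → (∀ {x} → Q x → P x)
             → count P? ≡ count Q?
  count-cong P? Q? P⇒Q Q⇒P = begin
    count P?                 ≡⟨ count≡∑𝟙 P? ⟩
    ∑ (λ x → 𝟙 (P? x))       ≡⟨ ∑-cong (λ x → 𝟙-cong (P? x) (Q? x) P⇒Q Q⇒P) ⟩
    ∑ (λ x → 𝟙 (Q? x))       ≡⟨ count≡∑𝟙 Q? ⟨
    count Q?                 ∎

  count-∅ : (P? : Decidable P) → (∀ {x} → ¬ P x) → count P? ≡ 0
  count-∅ P? ¬P = trans (count≡∑𝟙 P?)
    (trans (∑-cong (λ x → 𝟙-cong (P? x) (no id) ¬P ⊥-elim)) (ℕ-Sum.sum-replicate-zero size))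

  count-≡ : ∀ y → count (_≟ y) ≡ 1
  count-≡ y = begin
    count (_≟ y)
      ≡⟨ count≡∑𝟙 (_≟ y) ⟩
    ∑ (λ x → 𝟙 (x ≟ y))
      ≡⟨ ∑-cong (λ x → 𝟙-cong (x ≟ y) (from x Fin.≟ from y) (cong from) from-injective) ⟩
    ∑ (λ x → 𝟙 (from x Fin.≟ from y))
      ≡⟨ ℕ-Sum.sum-cong-≗ (λ i → cong (λ j → 𝟙 (j Fin.≟ from y)) (Inverse.strictlyInverseʳ enum i)) ⟩
    ℕ-Sum.sum (λ i → 𝟙 (i Fin.≟ from y))
      ≡⟨ sum-𝟙-≟ (from y) ⟩
    1 ∎
    where
    from = Inverse.from enum
    from-injective : ∀ {x} → from x ≡ from y → x ≡ y
    from-injective {x} eq = trans (sym (Inverse.strictlyInverseˡ enum x))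
      (trans (cong (Inverse.to enum) eq) (Inverse.strictlyInverseˡ enum y))

  count-all : count {P = λ _ → ⊤} (λ _ → yes tt) ≡ size
  count-all = begin
    List.length (filter (λ _ → yes tt) elements)
      ≡⟨ cong List.length (List.filter-all (λ _ → yes tt) (All.universal (λ _ → tt) elements)) ⟩
    List.length elements
      ≡⟨ List.length-map (Inverse.to enum) (List.allFin size) ⟩
    List.length (List.allFin size)
      ≡⟨ List.length-tabulate id ⟩
    size ∎

  count-⊎ : (P? : Decidable P) (Q? : Decidable Q) → (∀ {x} → P x → ¬ Q x)
          → count (λ x → P? x ⊎-dec Q? x) ≡ count P? N.+ count Q?
  count-⊎ {P} {Q} P? Q? P⇒¬Q = begin
    count (λ x → P? x ⊎-dec Q? x)               ≡⟨ count≡∑𝟙 _ ⟩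
    ∑ (λ x → 𝟙 (P? x ⊎-dec Q? x))               ≡⟨ ∑-cong (λ x → 𝟙-⊎ (P? x) (Q? x)) ⟩
    ∑ (λ x → 𝟙 (P? x) N.+ 𝟙 (Q? x))             ≡⟨ ∑-distrib (𝟙 ∘ P?) (𝟙 ∘ Q?) ⟩
    ∑ (λ x → 𝟙 (P? x)) N.+ ∑ (λ x → 𝟙 (Q? x))   ≡⟨ cong₂ N._+_ (count≡∑𝟙 P?) (count≡∑𝟙 Q?) ⟨
    count P? N.+ count Q?                       ∎
    where
    𝟙-⊎ : ∀ {x} (p : Dec (P x)) (q : Dec (Q x)) → 𝟙 (p ⊎-dec q) ≡ 𝟙 p N.+ 𝟙 q
    𝟙-⊎ (yes p) (yes q) = ⊥-elim (P⇒¬Q p q)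
    𝟙-⊎ (yes _) (no _)  = refl
    𝟙-⊎ (no _)  (yes _) = refl
    𝟙-⊎ (no _)  (no _)  = refl

  count-remove : (P? : Decidable P) → ∀ {y} → P y → count P? ≡ suc (count (λ x → ¬? (x ≟ y) ×-dec P? x))
  count-remove {P} P? {y} Py = begin
    count P?
      ≡⟨ count≡∑𝟙 P? ⟩
    ∑ (λ x → 𝟙 (P? x))
      ≡⟨ ∑-cong (λ x → 𝟙-split (x ≟ y) (P? x)) ⟩
    ∑ (λ x → 𝟙 (x ≟ y) N.+ 𝟙 (¬? (x ≟ y) ×-dec P? x))
      ≡⟨ ∑-distrib (λ x → 𝟙 (x ≟ y)) (λ x → 𝟙 (¬? (x ≟ y) ×-dec P? x)) ⟩
    ∑ (λ x → 𝟙 (x ≟ y)) N.+ ∑ (λ x → 𝟙 (¬? (x ≟ y) ×-dec P? x))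
      ≡⟨ cong₂ N._+_ (trans (sym (count≡∑𝟙 (_≟ y))) (count-≡ y)) (sym (count≡∑𝟙 _)) ⟩
    suc (count (λ x → ¬? (x ≟ y) ×-dec P? x)) ∎
    where
    𝟙-split : ∀ {x} (e : Dec (x ≡ y)) (p : Dec (P x)) → 𝟙 p ≡ 𝟙 e N.+ 𝟙 (¬? e ×-dec p)
    𝟙-split (yes refl) (yes _) = refl
    𝟙-split (yes refl) (no ¬p) = ⊥-elim (¬p Py)
    𝟙-split (no _)     (yes _) = refl
    𝟙-split (no _)     (no _)  = refl

  𝟙≡count-× : ∀ {A : Set} (a? : Dec A) y → 𝟙 a? ≡ count (λ w → a? ×-dec (y ≟ w))
  𝟙≡count-× (yes a) y = sym (trans (count-cong _ (_≟ y) (sym ∘ proj₂) (λ w≡y → a , sym w≡y)) (count-≡ y))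
  𝟙≡count-× (no ¬a) y = sym (count-∅ _ (¬a ∘ proj₁))

  count-fibres : (P? : Decidable P) (g : Carrier → Carrier)
               → count P? ≡ ∑ (λ w → count (λ y → P? y ×-dec (g y ≟ w)))
  count-fibres P? g = begin
    count P?
      ≡⟨ count≡∑𝟙 P? ⟩
    ∑ (λ y → 𝟙 (P? y))
      ≡⟨ ∑-cong (λ y → trans (𝟙≡count-× (P? y) (g y)) (count≡∑𝟙 _)) ⟩
    ∑ (λ y → ∑ (λ w → 𝟙 (P? y ×-dec (g y ≟ w))))
      ≡⟨ ∑-swap (λ y w → 𝟙 (P? y ×-dec (g y ≟ w))) ⟩
    ∑ (λ w → ∑ (λ y → 𝟙 (P? y ×-dec (g y ≟ w))))
      ≡⟨ ∑-cong (λ w → count≡∑𝟙 (λ y → P? y ×-dec (g y ≟ w))) ⟨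
    ∑ (λ w → count (λ y → P? y ×-dec (g y ≟ w))) ∎

  count-bijection : (P? : Decidable P) (Q? : Decidable Q) (g h : Carrier → Carrier)
    → (∀ {y} → P y → Q (g y)) → (∀ {w} → Q w → P (h w))
    → (∀ {w} → Q w → g (h w) ≡ w) → (∀ {y} → P y → h (g y) ≡ y)
    → count P? ≡ count Q?
  count-bijection {P} {Q} P? Q? g h P⇒Qg Q⇒Ph g∘h h∘g = begin
    count P?                                         ≡⟨ count-fibres P? g ⟩
    ∑ (λ w → count (λ y → P? y ×-dec (g y ≟ w)))     ≡⟨ ∑-cong fibre ⟩
    ∑ (λ w → 𝟙 (Q? w))                               ≡⟨ count≡∑𝟙 Q? ⟨
    count Q?                                         ∎
    where
    fibre : ∀ w → count (λ y → P? y ×-dec (g y ≟ w)) ≡ 𝟙 (Q? w)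
    fibre w with Q? w
    ... | yes Qw = trans (count-cong _ (_≟ h w) (λ (Py , gy≡w) → trans (sym (h∘g Py)) (cong h gy≡w))
                                                (λ { refl → Q⇒Ph Qw , g∘h Qw }))
                         (count-≡ (h w))
    ... | no ¬Qw = count-∅ _ (λ (Py , gy≡w) → ¬Qw (subst Q gy≡w (P⇒Qg Py)))

  size≡count*fibre : (Q? : Decidable Q) (g : Carrier → Carrier) (m : ℕ)
    → (∀ y → Q (g y)) → (∀ {w} → Q w → count (λ y → g y ≟ w) ≡ m)
    → size ≡ count Q? N.* m
  size≡count*fibre {Q} Q? g m Qg fibre = begin
    size
      ≡⟨ count-all ⟨
    count {P = λ _ → ⊤} (λ _ → yes tt)
      ≡⟨ count-fibres (λ _ → yes tt) g ⟩
    ∑ (λ w → count (λ y → yes tt ×-dec (g y ≟ w)))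
      ≡⟨ ∑-cong (λ w → trans (count-cong (λ y → yes tt ×-dec (g y ≟ w)) (λ y → g y ≟ w) proj₂ (tt ,_)) (fibre′ w)) ⟩
    ∑ (λ w → 𝟙 (Q? w) N.* m)
      ≡⟨ *-distribʳ-sum m (λ i → 𝟙 (Q? (Inverse.to enum i))) ⟨
    ∑ (λ w → 𝟙 (Q? w)) N.* m
      ≡⟨ cong (N._* m) (count≡∑𝟙 Q?) ⟨
    count Q? N.* m ∎
    where
    open Algebra.Properties.Semiring.Sum N.+-*-semiring using (*-distribʳ-sum)
    fibre′ : ∀ w → count (λ y → g y ≟ w) ≡ 𝟙 (Q? w) N.* m
    fibre′ w with Q? w
    ... | yes Qw = trans (fibre Qw) (sym (N.+-identityʳ m))
    ... | no ¬Qw = count-∅ _ (λ gy≡w → ¬Qw (subst Q gy≡w (Qg _)))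

module FunctionalGraph (K : FiniteField) where
  open FiniteField K

  module _ {f : Carrier → Carrier} {z : Carrier} (f∘f≡z : ∀ x → f (f x) ≡ z) where

    f∘f≡const⇒OneComponent : OneComponent f
    f∘f≡const⇒OneComponent x y = EqClosure.transitive (Edge f) (x∼z x) (EqClosure.symmetric (Edge f) (x∼z y))
      where
      x∼z : ∀ x → SameComponent f x z
      x∼z x = EqClosure.transitive (Edge f) (EqClosure.return refl) (EqClosure.return (f∘f≡z x))

    f∘f≡const⇒periodic≡const : ∀ x k → iter f (suc k) x ≡ x → x ≡ z
    f∘f≡const⇒periodic≡const x zero    fx≡x  = trans (sym fx≡x) (trans (cong f (sym fx≡x)) (f∘f≡z x))
    f∘f≡const⇒periodic≡const x (suc k) f²⁺ᵏx≡x = trans (sym f²⁺ᵏx≡x) (f∘f≡z (iter f k x))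

module Lagrange (K : FiniteField) where
  open FiniteField K
  open FieldArithmetic K
  open Counting K using (count-remove; count-all; count-cong; count≡∑𝟙)
  private
    module Additive       = Summation K (CommutativeRing.+-commutativeMonoid commutativeRing)
    module Multiplicative = Summation K (CommutativeRing.*-commutativeMonoid commutativeRing)
    module Product        = Algebra.Properties.CommutativeMonoid.Sum (CommutativeRing.*-commutativeMonoid commutativeRing)
  open ≡-Reasoning

  size·x≡0 : ∀ x → size · x ≡ 0#
  size·x≡0 x = +-identityʳ-unique (Additive.∑ id) (size · x) (begin
    Additive.∑ id + size · x                ≡⟨ cong (λ s → Additive.∑ id + s) (Additive.∑-const x) ⟨
    Additive.∑ id + Additive.∑ (λ _ → x)    ≡⟨ Additive.∑-distrib id (λ _ → x) ⟨
    Additive.∑ (_+ x)                       ≡⟨ Additive.∑-reindex translation id ⟨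
    Additive.∑ id                           ∎)
    where
    translation : Carrier ↔ Carrier
    translation = mk↔ₛ′ (_+ x) (_- x) (λ y → solve 2 (λ y x → (y :- x) :+ x := y) refl y x)
                                      (λ y → solve 2 (λ y x → (y :+ x) :- x := y) refl y x)

  nonzeroOr1 : Carrier → Carrier
  nonzeroOr1 y = if does (y ≟ 0#) then 1# else y

  nonzeroOr1-≢0 : ∀ y → ¬ nonzeroOr1 y ≡ 0#
  nonzeroOr1-≢0 y with y ≟ 0#
  ... | yes _   = 1≢0
  ... | no  y≢0 = y≢0

  nonzeroOr1-* : ∀ {x} → ¬ x ≡ 0# → ∀ y → nonzeroOr1 (x * y) ≡ x ^ 𝟙 (¬? (y ≟ 0#)) * nonzeroOr1 y
  nonzeroOr1-* {x} x≢0 y with y ≟ 0# | (x * y) ≟ 0#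
  ... | yes _   | yes _    = sym (*-identityˡ 1#)
  ... | yes y≡0 | no xy≢0  = ⊥-elim (xy≢0 (trans (cong (x *_) y≡0) (zeroʳ x)))
  ... | no  y≢0 | yes xy≡0 = ⊥-elim (*-≢0 x≢0 y≢0 xy≡0)
  ... | no  _   | no  _    = cong (_* y) (sym (*-identityʳ x))

  ∏-^ : ∀ x {n} (e : Fin n → ℕ) → Product.sum (λ i → x ^ e i) ≡ x ^ ℕ-Sum.sum e
  ∏-^ x {zero}  e = refl
  ∏-^ x {suc n} e = trans (cong (x ^ e Fin.zero *_) (∏-^ x (e ∘ Fin.suc))) (sym (^-homo-* x (e Fin.zero) _))

  ∏-≢0 : ∀ {n} (f : Fin n → Carrier) → (∀ i → ¬ f i ≡ 0#) → ¬ Product.sum f ≡ 0#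
  ∏-≢0 {zero}  f f≢0 = 1≢0
  ∏-≢0 {suc n} f f≢0 = *-≢0 (f≢0 Fin.zero) (∏-≢0 (f ∘ Fin.suc) (f≢0 ∘ Fin.suc))

  nonzeroCount : ℕ
  nonzeroCount = count (λ y → ¬? (y ≟ 0#))

  size≡1+nonzeroCount : size ≡ suc nonzeroCount
  size≡1+nonzeroCount = begin
    size
      ≡⟨ count-all ⟨
    count {P = λ _ → ⊤} (λ _ → yes tt)
      ≡⟨ count-remove (λ _ → yes tt) tt ⟩
    suc (count (λ y → ¬? (y ≟ 0#) ×-dec yes tt))
      ≡⟨ cong suc (count-cong _ (λ y → ¬? (y ≟ 0#)) proj₁ (_, tt)) ⟩
    suc nonzeroCount ∎

  -- Multiplication by x permutes the field and multiplies each nonzero factor of ∏ nonzeroOr1 by x.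
  x^nonzeroCount≡1 : ∀ {x} → ¬ x ≡ 0# → x ^ nonzeroCount ≡ 1#
  x^nonzeroCount≡1 {x} x≢0 = *-cancelʳ (∏-≢0 _ (nonzeroOr1-≢0 ∘ Inverse.to enum)) (begin
    x ^ nonzeroCount * Π
      ≡⟨ cong (λ k → x ^ k * Π) (count≡∑𝟙 (λ y → ¬? (y ≟ 0#))) ⟩
    x ^ ℕ-Sum.sum (λ i → e (Inverse.to enum i)) * Π
      ≡⟨ cong (_* Π) (∏-^ x {size} (e ∘ Inverse.to enum)) ⟨
    Multiplicative.∑ (λ y → x ^ e y) * Π
      ≡⟨ Multiplicative.∑-distrib (λ y → x ^ e y) nonzeroOr1 ⟨
    Multiplicative.∑ (λ y → x ^ e y * nonzeroOr1 y)
      ≡⟨ Multiplicative.∑-cong (λ y → sym (nonzeroOr1-* x≢0 y)) ⟩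
    Multiplicative.∑ (nonzeroOr1 ∘ (x *_))
      ≡⟨ Multiplicative.∑-reindex scaling nonzeroOr1 ⟨
    Π
      ≡⟨ *-identityˡ Π ⟨
    1# * Π ∎)
    where
    e : Carrier → ℕ
    e y = 𝟙 (¬? (y ≟ 0#))
    Π = Multiplicative.∑ nonzeroOr1
    scaling : Carrier ↔ Carrier
    scaling = mk↔ₛ′ (x *_) (x ⁻¹ *_)
      (λ y → trans (sym (*-assoc x (x ⁻¹) y)) (trans (cong (_* y) (*-inverseʳ x≢0)) (*-identityˡ y)))
      (λ y → trans (sym (*-assoc (x ⁻¹) x y)) (trans (cong (_* y) (*-inverseˡ x≢0)) (*-identityˡ y)))

  x^size≡x : ∀ x → x ^ size ≡ x
  x^size≡x x with x ≟ 0#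
  ... | yes refl = trans (cong (0# ^_) size≡1+nonzeroCount) (zeroˡ _)
  ... | no  x≢0  = begin
    x ^ size                 ≡⟨ cong (x ^_) size≡1+nonzeroCount ⟩
    x * x ^ nonzeroCount     ≡⟨ cong (x *_) (x^nonzeroCount≡1 x≢0) ⟩
    x * 1#                   ≡⟨ *-identityʳ x ⟩
    x                        ∎

module Frobenius (K : FiniteField) where
  open FiniteField K
  open FieldArithmetic K
  private
    module Exp = Algebra.Properties.CommutativeSemiring.Exp commutativeSemiring
    module Sum = Algebra.Properties.Semiring.Sum semiring
  open ≡-Reasoning

  ·≡·1* : ∀ n x → n · x ≡ (n · 1#) * x
  ·≡·1* n x = sym (trans (×-assoc-* n 1# x) (cong (n ·_) (*-identityˡ x)))

  module _ {p : ℕ} (p-prime : Prime p) (p·1≡0 : p · 1# ≡ 0#) where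

    ∣⇒·≡0 : ∀ {n} x → p ∣ n → n · x ≡ 0#
    ∣⇒·≡0 {n} x (divides d refl) = begin
      (d N.* p) · x                   ≡⟨ ·≡·1* (d N.* p) x ⟩
      ((d N.* p) · 1#) * x            ≡⟨ cong (_* x) (×1-homo-* d p) ⟩
      ((d · 1#) * (p · 1#)) * x       ≡⟨ cong (λ z → ((d · 1#) * z) * x) p·1≡0 ⟩
      ((d · 1#) * 0#) * x             ≡⟨ cong (_* x) (zeroʳ _) ⟩
      0# * x                          ≡⟨ zeroˡ x ⟩
      0#                              ∎

    ^p-homo-+ : ∀ x y → (x + y) ^ p ≡ x ^ p + y ^ p
    ^p-homo-+ x y = binomial p refl
      where
      open Algebra.Properties.Semiring.Binomial semiring x y using (binomialTerm; theorem)
      binomial : ∀ n → n ≡ p → (x + y) ^ n ≡ x ^ n + y ^ n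
      binomial (suc m) refl = begin
        (x + y) ^ suc m
          ≡⟨ ^≡Exp^ (x + y) (suc m) ⟩
        (x + y) Exp.^ suc m
          ≡⟨ theorem (*-comm x y) (suc m) ⟩
        binomialTerm (suc m) Fin.zero + Sum.sum u
          ≡⟨ cong (λ s → binomialTerm (suc m) Fin.zero + s) (Sum.sum-init-last u) ⟩
        binomialTerm (suc m) Fin.zero + (Sum.sum (u ∘ Fin.inject₁) + u (Fin.fromℕ m))
          ≡⟨ cong₂ (λ a b → a + (b + u (Fin.fromℕ m)))
                   first (trans (Sum.sum-cong-≋ middle) (Sum.sum-replicate-zero m)) ⟩
        y ^ suc m + (0# + u (Fin.fromℕ m))
          ≡⟨ cong (λ b → y ^ suc m + b)
                  (trans (+-identityˡ _) (last (Fin.toℕ (Fin.fromℕ m)) (Fin.toℕ-fromℕ m))) ⟩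
        y ^ suc m + x ^ suc m
          ≡⟨ +-comm _ _ ⟩
        x ^ suc m + y ^ suc m ∎
        where
        u : Fin (suc m) → Carrier
        u i = binomialTerm (suc m) (Fin.suc i)
        first : binomialTerm (suc m) Fin.zero ≡ y ^ suc m
        first = trans (+-identityʳ _) (trans (*-identityˡ _) (sym (^≡Exp^ y (suc m))))
        middle : ∀ i → u (Fin.inject₁ i) ≡ 0#
        middle i = ∣⇒·≡0 _ (p∣pCk p-prime (N.s≤s N.z≤n)
                              (N.s≤s (subst (N._< m) (sym (Fin.toℕ-inject₁ i)) (Fin.toℕ<n i))))
        last : ∀ j → j ≡ m → (suc m C suc j) · (x Exp.^ suc j * y Exp.^ (m ∸ j)) ≡ x ^ suc m
        last j refl = begin
          (suc m C suc m) · (x Exp.^ suc m * y Exp.^ (m ∸ m))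
            ≡⟨ cong₂ (λ c e → c · (x Exp.^ suc m * y Exp.^ e)) (nCn≡1 (suc m)) (N.n∸n≡0 m) ⟩
          1 · (x Exp.^ suc m * 1#)
            ≡⟨ +-identityʳ _ ⟩
          x Exp.^ suc m * 1#
            ≡⟨ *-identityʳ _ ⟩
          x Exp.^ suc m
            ≡⟨ ^≡Exp^ x (suc m) ⟨
          x ^ suc m ∎

    ^p^k-homo-+ : ∀ k x y → (x + y) ^ (p N.^ k) ≡ x ^ (p N.^ k) + y ^ (p N.^ k)
    ^p^k-homo-+ zero    x y = trans (*-identityʳ _) (sym (cong₂ _+_ (*-identityʳ x) (*-identityʳ y)))
    ^p^k-homo-+ (suc k) x y = begin
      (x + y) ^ (p N.* p N.^ k)                   ≡⟨ ^-assocʳ (x + y) p (p N.^ k) ⟨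
      ((x + y) ^ p) ^ (p N.^ k)                   ≡⟨ cong (_^ (p N.^ k)) (^p-homo-+ x y) ⟩
      (x ^ p + y ^ p) ^ (p N.^ k)                 ≡⟨ ^p^k-homo-+ k (x ^ p) (y ^ p) ⟩
      (x ^ p) ^ (p N.^ k) + (y ^ p) ^ (p N.^ k)   ≡⟨ cong₂ _+_ (^-assocʳ x p _) (^-assocʳ y p _) ⟩
      x ^ (p N.* p N.^ k) + y ^ (p N.* p N.^ k)   ∎

module QuadraticExtension (K : FiniteField) {p k q : ℕ}
  (p-prime : Prime p) (p-odd : ¬ 2 ∣ p) (k≥1 : 1 N.≤ k) (q≡p^k : q ≡ p N.^ k)
  (size≡q*q : FiniteField.size K ≡ q N.* q) where

  open FiniteField K
  open FieldArithmetic K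
  open Counting K
  open Lagrange K using (size·x≡0; x^size≡x)
  open Frobenius K using (^p^k-homo-+)
  open ≡-Reasoning

  1<q : 1 N.< q
  1<q = subst (1 N.<_) (sym q≡p^k) (1<p^k p-prime k≥1)

  q·1≡0 : q · 1# ≡ 0#
  q·1≡0 = [ id , id ]′ (x*y≡0⇒x≡0⊎y≡0 (q · 1#) (q · 1#) (begin
    (q · 1#) * (q · 1#)   ≡⟨ ×1-homo-* q q ⟨
    (q N.* q) · 1#        ≡⟨ cong (_· 1#) size≡q*q ⟨
    size · 1#             ≡⟨ size·x≡0 1# ⟩
    0#                    ∎))

  p·1≡0 : p · 1# ≡ 0#
  p·1≡0 = x^n≡0⇒x≡0 k (begin
    (p · 1#) ^ k          ≡⟨ ·1-homo-^ p k ⟨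
    (p N.^ k) · 1#        ≡⟨ cong (_· 1#) q≡p^k ⟨
    q · 1#                ≡⟨ q·1≡0 ⟩
    0#                    ∎)

  2≢0 : ¬ 2# ≡ 0#
  2≢0 2≡0 = 1≢0 (begin
    1#
      ≡⟨ +-identityʳ 1# ⟨
    1# + 0#
      ≡⟨ cong (λ z → 1# + z) (zeroʳ (h · 1#)) ⟨
    1# + (h · 1#) * 0#
      ≡⟨ cong (λ z → 1# + (h · 1#) * z) (trans (cong (λ z → 1# + z) (+-identityʳ 1#)) 2≡0) ⟨
    1# + (h · 1#) * (2 · 1#)
      ≡⟨ cong (λ z → 1# + z) (×1-homo-* h 2) ⟨
    suc (h N.* 2) · 1#
      ≡⟨ cong (_· 1#) p≡1+h*2 ⟨
    p · 1#
      ≡⟨ p·1≡0 ⟩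
    0# ∎)
    where
    h = proj₁ (¬2∣n⇒n≡1+h*2 p-odd)
    p≡1+h*2 = proj₂ (¬2∣n⇒n≡1+h*2 p-odd)

  ^q-homo-+ : ∀ x y → (x + y) ^ q ≡ x ^ q + y ^ q
  ^q-homo-+ x y = subst (λ n → (x + y) ^ n ≡ x ^ n + y ^ n) (sym q≡p^k) (^p^k-homo-+ p-prime p·1≡0 k x y)

  q∸1≢0 : ¬ q ∸ 1 ≡ 0
  q∸1≢0 q∸1≡0 = N.<-irrefl (sym q∸1≡0) (N.m<n⇒0<n∸m 1<q)

  0^q≡0 : 0# ^ q ≡ 0#
  0^q≡0 = 0^n≡0 (N.<⇒≤ 1<q)

  ^q-homo-neg : ∀ x → (- x) ^ q ≡ - (x ^ q)
  ^q-homo-neg x = +-inverseˡ-unique ((- x) ^ q) (x ^ q) (begin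
    (- x) ^ q + x ^ q     ≡⟨ ^q-homo-+ (- x) x ⟨
    (- x + x) ^ q         ≡⟨ cong (_^ q) (-‿inverseˡ x) ⟩
    0# ^ q                ≡⟨ 0^q≡0 ⟩
    0#                    ∎)

  ^q-homo-sub : ∀ x y → (x - y) ^ q ≡ x ^ q - y ^ q
  ^q-homo-sub x y = trans (^q-homo-+ x (- y)) (cong (λ z → x ^ q + z) (^q-homo-neg y))

  ^q-involutive : ∀ x → (x ^ q) ^ q ≡ x
  ^q-involutive x = trans (^-assocʳ x q q) (trans (cong (x ^_) (sym size≡q*q)) (x^size≡x x))

  Fixed Skew : Pred Carrier 0ℓ
  Fixed x = x ^ q ≡ x
  Skew  x = x ^ q ≡ - x

  Fixed? : Decidable Fixed
  Fixed? x = (x ^ q) ≟ x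

  Skew? : Decidable Skew
  Skew? x = (x ^ q) ≟ (- x)

  Fixed-0 : Fixed 0#
  Fixed-0 = 0^q≡0

  Skew-0 : Skew 0#
  Skew-0 = trans 0^q≡0 (sym -0#≈0#)

  Fixed-+ : ∀ {x y} → Fixed x → Fixed y → Fixed (x + y)
  Fixed-+ {x} {y} x^q≡x y^q≡y = trans (^q-homo-+ x y) (cong₂ _+_ x^q≡x y^q≡y)

  Fixed-* : ∀ {x y} → Fixed x → Fixed y → Fixed (x * y)
  Fixed-* {x} {y} x^q≡x y^q≡y = trans (^-distrib-* x y q) (cong₂ _*_ x^q≡x y^q≡y)

  Fixed-*-Skew : ∀ {x y} → Fixed x → Skew y → Skew (x * y)
  Fixed-*-Skew {x} {y} x^q≡x y^q≡-y = trans (^-distrib-* x y q) (trans (cong₂ _*_ x^q≡x y^q≡-y) (sym (-‿distribʳ-* x y)))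

  Skew-*-Skew : ∀ {x y} → Skew x → Skew y → Fixed (x * y)
  Skew-*-Skew {x} {y} x^q≡-x y^q≡-y = begin
    (x * y) ^ q        ≡⟨ ^-distrib-* x y q ⟩
    x ^ q * y ^ q      ≡⟨ cong₂ _*_ x^q≡-x y^q≡-y ⟩
    - x * - y          ≡⟨ solve 2 (λ x y → (:- x) :* (:- y) := x :* y) refl x y ⟩
    x * y              ∎

  Skew-^-odd : ∀ {x} j → Skew x → Skew (x ^ suc (j N.* 2))
  Skew-^-odd     zero    Skew-x = trans (^-distrib-* _ 1# q) (trans (cong₂ _*_ Skew-x (1^n≡1 q)) (sym (-‿distribˡ-* _ 1#)))
  Skew-^-odd {x} (suc j) Skew-x = subst Skew (*-assoc x x _) (Fixed-*-Skew (Skew-*-Skew Skew-x Skew-x) (Skew-^-odd j Skew-x))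

  x⁻¹^q*x^q≡1 : ∀ {x} → ¬ x ≡ 0# → (x ⁻¹) ^ q * x ^ q ≡ 1#
  x⁻¹^q*x^q≡1 {x} x≢0 = trans (sym (^-distrib-* (x ⁻¹) x q)) (trans (cong (_^ q) (*-inverseˡ x≢0)) (1^n≡1 q))

  Fixed-⁻¹ : ∀ {x} → ¬ x ≡ 0# → Fixed x → Fixed (x ⁻¹)
  Fixed-⁻¹ {x} x≢0 x^q≡x = *-cancelʳ x≢0 (begin
    (x ⁻¹) ^ q * x           ≡⟨ cong ((x ⁻¹) ^ q *_) x^q≡x ⟨
    (x ⁻¹) ^ q * x ^ q       ≡⟨ x⁻¹^q*x^q≡1 x≢0 ⟩
    1#                       ≡⟨ *-inverseˡ x≢0 ⟨
    x ⁻¹ * x                 ∎)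

  Skew-⁻¹ : ∀ {x} → ¬ x ≡ 0# → Skew x → Skew (x ⁻¹)
  Skew-⁻¹ {x} x≢0 x^q≡-x = *-cancelʳ x≢0 (begin
    (x ⁻¹) ^ q * x           ≡⟨ solve 2 (λ a x → a :* x := :- (a :* (:- x))) refl ((x ⁻¹) ^ q) x ⟩
    - ((x ⁻¹) ^ q * - x)     ≡⟨ cong (λ z → - ((x ⁻¹) ^ q * z)) x^q≡-x ⟨
    - ((x ⁻¹) ^ q * x ^ q)   ≡⟨ cong -_ (trans (x⁻¹^q*x^q≡1 x≢0) (sym (*-inverseˡ x≢0))) ⟩
    - (x ⁻¹ * x)             ≡⟨ -‿distribˡ-* (x ⁻¹) x ⟩
    - (x ⁻¹) * x             ∎)

  Fixed∧Skew⇒0 : ∀ {x} → Fixed x → Skew x → x ≡ 0#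
  Fixed∧Skew⇒0 {x} x^q≡x x^q≡-x = x*y≡0⇒x≡0 2≢0 (begin
    x * 2#       ≡⟨ trans (x+x≡2#*x x) (*-comm 2# x) ⟨
    x + x        ≡⟨ cong (x +_) (trans (sym x^q≡x) x^q≡-x) ⟩
    x + - x      ≡⟨ -‿inverseʳ x ⟩
    0#           ∎)

  Fixed-square⇒Fixed⊎Skew : ∀ {x} → Fixed (x * x) → Fixed x ⊎ Skew x
  Fixed-square⇒Fixed⊎Skew {x} [x*x]^q≡x*x =
    ⊎.map x-y≡0⇒x≡y (λ x^q+x≡0 → +-inverseˡ-unique (x ^ q) x x^q+x≡0)
      (x*y≡0⇒x≡0⊎y≡0 (x ^ q - x) (x ^ q + x) (begin
        (x ^ q - x) * (x ^ q + x)
          ≡⟨ solve 2 (λ X x → (X :- x) :* (X :+ x) := X :* X :- x :* x) refl (x ^ q) x ⟩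
        x ^ q * x ^ q - x * x
          ≡⟨ cong (_- x * x) (trans (sym (^-distrib-* x x q)) [x*x]^q≡x*x) ⟩
        x * x - x * x
          ≡⟨ -‿inverseʳ (x * x) ⟩
        0# ∎))

  trace antitrace : Carrier → Carrier
  trace     y = y ^ q + y
  antitrace y = y ^ q - y

  Fixed-trace : ∀ y → Fixed (trace y)
  Fixed-trace y = trans (^q-homo-+ (y ^ q) y) (trans (cong (_+ y ^ q) (^q-involutive y)) (+-comm y (y ^ q)))

  Skew-antitrace : ∀ y → Skew (antitrace y)
  Skew-antitrace y = begin
    (y ^ q - y) ^ q          ≡⟨ ^q-homo-sub (y ^ q) y ⟩
    (y ^ q) ^ q - y ^ q      ≡⟨ cong (_- y ^ q) (^q-involutive y) ⟩
    y - y ^ q                ≡⟨ solve 2 (λ y Y → y :- Y := :- (Y :- y)) refl y (y ^ q) ⟩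
    - (y ^ q - y)            ∎

  half : Carrier
  half = 2# ⁻¹

  [x+x]*half≡x : ∀ x → (x + x) * half ≡ x
  [x+x]*half≡x x = begin
    (x + x) * half     ≡⟨ cong (_* half) (trans (x+x≡2#*x x) (*-comm 2# x)) ⟩
    (x * 2#) * half    ≡⟨ *-assoc x 2# half ⟩
    x * (2# * half)    ≡⟨ cong (x *_) (*-inverseʳ 2≢0) ⟩
    x * 1#             ≡⟨ *-identityʳ x ⟩
    x                  ∎

  Fixed-half : Fixed half
  Fixed-half = Fixed-⁻¹ 2≢0 (Fixed-+ (1^n≡1 q) (1^n≡1 q))

  [trace-antitrace]*half≡id : ∀ y → (trace y - antitrace y) * half ≡ y
  [trace-antitrace]*half≡id y = begin
    (trace y - antitrace y) * half
      ≡⟨ cong (_* half) (solve 2 (λ Y y → (Y :+ y) :- (Y :- y) := y :+ y) refl (y ^ q) y) ⟩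
    (y + y) * half
      ≡⟨ [x+x]*half≡x y ⟩
    y ∎

  module _ {t w} (Fixed-t : Fixed t) (Skew-w : Skew w) where

    [[t-w]*half]^q≡[t+w]*half : ((t - w) * half) ^ q ≡ (t + w) * half
    [[t-w]*half]^q≡[t+w]*half = begin
      ((t - w) * half) ^ q             ≡⟨ ^-distrib-* (t - w) half q ⟩
      (t - w) ^ q * half ^ q           ≡⟨ cong₂ _*_ (^q-homo-sub t w) Fixed-half ⟩
      (t ^ q - w ^ q) * half           ≡⟨ cong₂ (λ a b → (a - b) * half) Fixed-t Skew-w ⟩
      (t - - w) * half                 ≡⟨ cong (λ z → (t + z) * half) (-‿involutive w) ⟩
      (t + w) * half                   ∎

    trace-[t-w]*half : trace ((t - w) * half) ≡ t
    trace-[t-w]*half = begin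
      ((t - w) * half) ^ q + (t - w) * half
        ≡⟨ cong (_+ (t - w) * half) [[t-w]*half]^q≡[t+w]*half ⟩
      (t + w) * half + (t - w) * half
        ≡⟨ solve 3 (λ t w h → (t :+ w) :* h :+ (t :- w) :* h := (t :+ t) :* h) refl t w half ⟩
      (t + t) * half
        ≡⟨ [x+x]*half≡x t ⟩
      t ∎

    antitrace-[t-w]*half : antitrace ((t - w) * half) ≡ w
    antitrace-[t-w]*half = begin
      ((t - w) * half) ^ q - (t - w) * half
        ≡⟨ cong (_- (t - w) * half) [[t-w]*half]^q≡[t+w]*half ⟩
      (t + w) * half - (t - w) * half
        ≡⟨ solve 3 (λ t w h → (t :+ w) :* h :- (t :- w) :* h := (w :+ w) :* h) refl t w half ⟩
      (w + w) * half
        ≡⟨ [x+x]*half≡x w ⟩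
      w ∎

  count-antitrace-fibre : ∀ {w} → Skew w → count (λ y → antitrace y ≟ w) ≡ count Fixed?
  count-antitrace-fibre {w} Skew-w =
    count-bijection (λ y → antitrace y ≟ w) Fixed? trace (λ t → (t - w) * half)
      (λ {y} _ → Fixed-trace y)
      (λ Fixed-t → antitrace-[t-w]*half Fixed-t Skew-w)
      (λ Fixed-t → trace-[t-w]*half Fixed-t Skew-w)
      (λ {y} antitrace-y≡w → subst (λ z → (trace y - z) * half ≡ y) antitrace-y≡w ([trace-antitrace]*half≡id y))

  module _ {β} (Skew-β : Skew β) (β≢0 : ¬ β ≡ 0#) where

    count-Skew≡count-Fixed : count Skew? ≡ count Fixed?
    count-Skew≡count-Fixed = count-bijection Skew? Fixed? (_* β) (_* β ⁻¹)
      (λ Skew-y → Skew-*-Skew Skew-y Skew-β)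
      (λ Fixed-w → Fixed-*-Skew Fixed-w (Skew-⁻¹ β≢0 Skew-β))
      (λ {w} _ → trans (*-assoc w (β ⁻¹) β) (trans (cong (w *_) (*-inverseˡ β≢0)) (*-identityʳ w)))
      (λ {y} _ → trans (*-assoc y β (β ⁻¹)) (trans (cong (y *_) (*-inverseʳ β≢0)) (*-identityʳ y)))

    count-Fixed≡q : count Fixed? ≡ q
    count-Fixed≡q = m*m≡n*n⇒m≡n (begin
      count Fixed? N.* count Fixed?
        ≡⟨ cong (N._* count Fixed?) count-Skew≡count-Fixed ⟨
      count Skew? N.* count Fixed?
        ≡⟨ size≡count*fibre Skew? antitrace (count Fixed?) Skew-antitrace count-antitrace-fibre ⟨
      size
        ≡⟨ size≡q*q ⟩
      q N.* q ∎)

    count-Skew≡q : count Skew? ≡ q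
    count-Skew≡q = trans count-Skew≡count-Fixed count-Fixed≡q

    count-nonzero-Fixed : count (λ x → ¬? (x ≟ 0#) ×-dec Fixed? x) ≡ q ∸ 1
    count-nonzero-Fixed = cong (_∸ 1) (trans (sym (count-remove Fixed? Fixed-0)) count-Fixed≡q)

    count-nonzero-Skew : count (λ x → ¬? (x ≟ 0#) ×-dec Skew? x) ≡ q ∸ 1
    count-nonzero-Skew = cong (_∸ 1) (trans (sym (count-remove Skew? Skew-0)) count-Skew≡q)

  module Map {a c} (Fixed-a : Fixed a) (a≢0 : ¬ a ≡ 0#) (a≡c : a ≡ c)
             {e} (e-odd : Σ ℕ (λ j → e ≡ suc (j N.* 2))) where

    f : Carrier → Carrier
    f X = (c * X ^ q + a * X) * (X ^ q - X) ^ e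

    f≡a*trace*antitrace^e : ∀ y → f y ≡ (a * trace y) * antitrace y ^ e
    f≡a*trace*antitrace^e y = cong (_* antitrace y ^ e)
      (trans (cong (λ c → c * y ^ q + a * y) (sym a≡c)) (sym (distribˡ a (y ^ q) y)))

    0^e≡0 : 0# ^ e ≡ 0#
    0^e≡0 = 0^n≡0 (subst (1 N.≤_) (sym (proj₂ e-odd)) (N.s≤s N.z≤n))

    Skew-^e : ∀ {w} → Skew w → Skew (w ^ e)
    Skew-^e Skew-w = subst (λ n → Skew (_ ^ n)) (sym (proj₂ e-odd)) (Skew-^-odd (proj₁ e-odd) Skew-w)

    f-Fixed : ∀ {y} → Fixed y → f y ≡ 0#
    f-Fixed {y} y^q≡y = begin
      f y
        ≡⟨ f≡a*trace*antitrace^e y ⟩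
      (a * trace y) * antitrace y ^ e
        ≡⟨ cong (λ z → (a * trace y) * z ^ e) (trans (cong (_- y) y^q≡y) (-‿inverseʳ y)) ⟩
      (a * trace y) * 0# ^ e
        ≡⟨ cong ((a * trace y) *_) 0^e≡0 ⟩
      (a * trace y) * 0#
        ≡⟨ zeroʳ _ ⟩
      0# ∎

    f-Skew : ∀ {y} → Skew y → f y ≡ 0#
    f-Skew {y} y^q≡-y = begin
      f y
        ≡⟨ f≡a*trace*antitrace^e y ⟩
      (a * trace y) * antitrace y ^ e
        ≡⟨ cong (λ z → (a * z) * antitrace y ^ e) (trans (cong (_+ y) y^q≡-y) (-‿inverseˡ y)) ⟩
      (a * 0#) * antitrace y ^ e
        ≡⟨ cong (_* antitrace y ^ e) (zeroʳ a) ⟩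
      0# * antitrace y ^ e
        ≡⟨ zeroˡ _ ⟩
      0# ∎

    f≡0⇒Fixed⊎Skew : ∀ {y} → f y ≡ 0# → Fixed y ⊎ Skew y
    f≡0⇒Fixed⊎Skew {y} fy≡0 with x*y≡0⇒x≡0⊎y≡0 _ _ (trans (sym (f≡a*trace*antitrace^e y)) fy≡0)
    ... | inj₂ antitrace^e≡0 = inj₁ (x-y≡0⇒x≡y (x^n≡0⇒x≡0 e antitrace^e≡0))
    ... | inj₁ a*trace≡0     = inj₂ ([ ⊥-elim ∘ a≢0 , (λ trace≡0 → +-inverseˡ-unique (y ^ q) y trace≡0) ]′
                                       (x*y≡0⇒x≡0⊎y≡0 a (trace y) a*trace≡0))

    Skew-f : ∀ y → Skew (f y)
    Skew-f y = subst Skew (sym (f≡a*trace*antitrace^e y))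
      (Fixed-*-Skew (Fixed-* Fixed-a (Fixed-trace y)) (Skew-^e (Skew-antitrace y)))

    f∘f≡0 : ∀ y → f (f y) ≡ 0#
    f∘f≡0 y = f-Skew (Skew-f y)

    preimageSize-Fixed : ∀ {s} → Fixed s → ¬ s ≡ 0# → preimageSize f s ≡ 0
    preimageSize-Fixed {s} Fixed-s s≢0 =
      count-∅ (λ y → f y ≟ s) (λ {y} fy≡s → s≢0 (Fixed∧Skew⇒0 Fixed-s (subst Skew fy≡s (Skew-f y))))

    module _ {s} (Skew-s : Skew s) (s≢0 : ¬ s ≡ 0#) where

      trace-of : Carrier → Carrier
      trace-of w = s * (a * w ^ e) ⁻¹

      preimage : Carrier → Carrier
      preimage w = (trace-of w - w) * half

      Fixed-trace-of : ∀ {w} → ¬ w ≡ 0# → Skew w → Fixed (trace-of w)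
      Fixed-trace-of w≢0 Skew-w = Skew-*-Skew Skew-s
        (Skew-⁻¹ (*-≢0 a≢0 (^-≢0 e w≢0)) (Fixed-*-Skew Fixed-a (Skew-^e Skew-w)))

      f-preimage : ∀ {w} → ¬ w ≡ 0# → Skew w → f (preimage w) ≡ s
      f-preimage {w} w≢0 Skew-w = begin
        f (preimage w)
          ≡⟨ f≡a*trace*antitrace^e (preimage w) ⟩
        (a * trace (preimage w)) * antitrace (preimage w) ^ e
          ≡⟨ cong₂ (λ t d → (a * t) * d ^ e)
                   (trace-[t-w]*half Fixed-t Skew-w) (antitrace-[t-w]*half Fixed-t Skew-w) ⟩
        (a * (s * L ⁻¹)) * w ^ e
          ≡⟨ solve 4 (λ a s i d → (a :* (s :* i)) :* d := s :* (i :* (a :* d))) refl a s (L ⁻¹) (w ^ e) ⟩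
        s * (L ⁻¹ * L)
          ≡⟨ cong (s *_) (*-inverseˡ (*-≢0 a≢0 (^-≢0 e w≢0))) ⟩
        s * 1#
          ≡⟨ *-identityʳ s ⟩
        s ∎
        where
        L = a * w ^ e
        Fixed-t = Fixed-trace-of w≢0 Skew-w

      trace-of-antitrace : ∀ {y} → f y ≡ s → trace-of (antitrace y) ≡ trace y
      trace-of-antitrace {y} fy≡s = begin
        s * L ⁻¹                ≡⟨ cong (_* L ⁻¹) s≡T*L ⟩
        (trace y * L) * L ⁻¹    ≡⟨ *-assoc (trace y) L (L ⁻¹) ⟩
        trace y * (L * L ⁻¹)    ≡⟨ cong (trace y *_) (*-inverseʳ L≢0) ⟩
        trace y * 1#            ≡⟨ *-identityʳ (trace y) ⟩
        trace y                 ∎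
        where
        L = a * antitrace y ^ e
        s≡T*L : s ≡ trace y * L
        s≡T*L = trans (sym fy≡s) (trans (f≡a*trace*antitrace^e y)
                  (solve 3 (λ a T D → (a :* T) :* D := T :* (a :* D)) refl a (trace y) (antitrace y ^ e)))
        L≢0 : ¬ L ≡ 0#
        L≢0 L≡0 = s≢0 (trans s≡T*L (trans (cong (trace y *_) L≡0) (zeroʳ (trace y))))

      preimageSize-Skew : ∀ {β} → Skew β → ¬ β ≡ 0# → preimageSize f s ≡ q ∸ 1
      preimageSize-Skew Skew-β β≢0 = trans
        (count-bijection (λ y → f y ≟ s) (λ w → ¬? (w ≟ 0#) ×-dec Skew? w) antitrace preimage
          (λ {y} fy≡s → (λ antitrace≡0 → s≢0 (trans (sym fy≡s) (f-Fixed (x-y≡0⇒x≡y antitrace≡0))))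
                       , Skew-antitrace y)
          (λ (w≢0 , Skew-w) → f-preimage w≢0 Skew-w)
          (λ (w≢0 , Skew-w) → antitrace-[t-w]*half (Fixed-trace-of w≢0 Skew-w) Skew-w)
          (λ {y} fy≡s → trans (cong (λ t → (t - antitrace y) * half) (trace-of-antitrace fy≡s))
                              ([trace-antitrace]*half≡id y)))
        (count-nonzero-Skew Skew-β β≢0)

    module _ {β} (Skew-β : Skew β) (β≢0 : ¬ β ≡ 0#) where

      count-nonzero-zeros : count (λ x → ¬? (x ≟ 0#) ×-dec (f x ≟ 0#)) ≡ 2 N.* q ∸ 2
      count-nonzero-zeros = begin
        count (λ x → ¬? (x ≟ 0#) ×-dec (f x ≟ 0#))
          ≡⟨ count-cong _ (λ x → (¬? (x ≟ 0#) ×-dec Fixed? x) ⊎-dec (¬? (x ≟ 0#) ×-dec Skew? x))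
               (λ (x≢0 , fx≡0) → ⊎.map (x≢0 ,_) (x≢0 ,_) (f≡0⇒Fixed⊎Skew fx≡0))
               [ (λ (x≢0 , Fixed-x) → x≢0 , f-Fixed Fixed-x) , (λ (x≢0 , Skew-x) → x≢0 , f-Skew Skew-x) ]′ ⟩
        count (λ x → (¬? (x ≟ 0#) ×-dec Fixed? x) ⊎-dec (¬? (x ≟ 0#) ×-dec Skew? x))
          ≡⟨ count-⊎ _ _ (λ (x≢0 , Fixed-x) (_ , Skew-x) → x≢0 (Fixed∧Skew⇒0 Fixed-x Skew-x)) ⟩
        count (λ x → ¬? (x ≟ 0#) ×-dec Fixed? x) N.+ count (λ x → ¬? (x ≟ 0#) ×-dec Skew? x)
          ≡⟨ cong₂ N._+_ (count-nonzero-Fixed Skew-β β≢0) (count-nonzero-Skew Skew-β β≢0) ⟩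
        (q ∸ 1) N.+ (q ∸ 1)
          ≡⟨ n∸1+n∸1≡2*n∸2 q ⟩
        2 N.* q ∸ 2
          ∎

      count-nonzero-zeros-with-preimageSize-q∸1 :
        count (λ x → ¬? (x ≟ 0#) ×-dec ((f x ≟ 0#) ×-dec (preimageSize f x N.≟ (q ∸ 1)))) ≡ q ∸ 1
      count-nonzero-zeros-with-preimageSize-q∸1 =
        trans (count-cong _ (λ x → ¬? (x ≟ 0#) ×-dec Skew? x) to from) (count-nonzero-Skew Skew-β β≢0)
        where
        to : ∀ {x} → ¬ x ≡ 0# × f x ≡ 0# × preimageSize f x ≡ q ∸ 1 → ¬ x ≡ 0# × Skew x
        to (x≢0 , fx≡0 , preimage≡q∸1) with f≡0⇒Fixed⊎Skew fx≡0
        ... | inj₁ Fixed-x = ⊥-elim (q∸1≢0 (trans (sym preimage≡q∸1) (preimageSize-Fixed Fixed-x x≢0)))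
        ... | inj₂ Skew-x  = x≢0 , Skew-x
        from : ∀ {x} → ¬ x ≡ 0# × Skew x → ¬ x ≡ 0# × f x ≡ 0# × preimageSize f x ≡ q ∸ 1
        from (x≢0 , Skew-x) = x≢0 , f-Skew Skew-x , preimageSize-Skew Skew-x x≢0 Skew-β β≢0

mainTheorem1 : (q : ℕ) → Σ ℕ (λ p → Σ ℕ (λ k → Prime p × ¬ (2 ∣ p) × 1 ≤ k × q ≡ p N.^ k))
  → (n : ℕ) → 2 ≤ n → 2 ∣ n
  → (K : FiniteField) → FiniteField.size K ≡ q N.* q
  → let open FiniteField K in
    (a c : Carrier) → a ^ q ≡ a → c ^ q ≡ c → ¬ (a ≡ 0# × c ≡ 0#)
  → (β : Carrier) → ¬ (β ^ q ≡ β) → (β * β) ^ q ≡ β * β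
  → (a - c) * ((- 2#) ^ (n ∸ 1)) * (β ^ n) ≡ 0#
  → let f : Carrier → Carrier
        f X = (c * (X ^ q) + a * X) * ((X ^ q - X) ^ (n ∸ 1))
    in OneComponent f
       × f 0# ≡ 0#
       × (∀ x k → iter f (N.suc k) x ≡ x → x ≡ 0#)
       × count (λ x → ¬? (x ≟ 0#) ×-dec (f x ≟ 0#)) ≡ 2 N.* q ∸ 2
       × count (λ x → ¬? (x ≟ 0#) ×-dec ((f x ≟ 0#) ×-dec (preimageSize f x N.≟ (q ∸ 1)))) ≡ q ∸ 1
mainTheorem1 q (p , k , p-prime , p-odd , k≥1 , q≡p^k) n 2≤n 2∣n K size≡q*q
             a c Fixed-a _ ¬a≡0×c≡0 β ¬Fixed-β Fixed-β*β δ₁≡0 =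
  f∘f≡const⇒OneComponent f∘f≡0 , f-Fixed Fixed-0 , f∘f≡const⇒periodic≡const {f = f} f∘f≡0 ,
  count-nonzero-zeros Skew-β β≢0 , count-nonzero-zeros-with-preimageSize-q∸1 Skew-β β≢0
  where
  open FiniteField K
  open FieldArithmetic K
  open FunctionalGraph K
  open QuadraticExtension K p-prime p-odd k≥1 q≡p^k size≡q*q

  β≢0 : ¬ β ≡ 0#
  β≢0 β≡0 = ¬Fixed-β (subst Fixed (sym β≡0) Fixed-0)

  Skew-β : Skew β
  Skew-β = [ ⊥-elim ∘ ¬Fixed-β , id ]′ (Fixed-square⇒Fixed⊎Skew Fixed-β*β)

  -2≢0 : ¬ - 2# ≡ 0#
  -2≢0 -2≡0 = 2≢0 (trans (sym (-‿involutive 2#)) (trans (cong -_ -2≡0) -0#≈0#))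

  a≡c : a ≡ c
  a≡c = x-y≡0⇒x≡y (x*y≡0⇒x≡0 (^-≢0 (n ∸ 1) -2≢0) (x*y≡0⇒x≡0 (^-≢0 n β≢0) δ₁≡0))

  a≢0 : ¬ a ≡ 0#
  a≢0 a≡0 = ¬a≡0×c≡0 (a≡0 , trans (sym a≡c) a≡0)

  open Map Fixed-a a≢0 a≡c (2∣n⇒n∸1≡1+j*2 2≤n 2∣n)
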